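{- For every positive integer $q$, \[ \sum_{d\mid q}V(d)=q^{1-s}6^{ -s}\mathcal{M}_m(6q,q). \]
   Context: Fix positive integers $s$ and $m$. Let $S_n=\frac{2n^3+3n^2+n}{6}$, $e(x)=e^{2\pi i x}$, $V(q,a)=\sum_{1\le n\le 6q}e\left(\frac{a}{q}S_n\right)$, and $V(q)=\sum_{1\le a\le q,\ (a,q)=1}\left(\frac{V(q,a)}{6q}\right)^s e\left(-\frac{am}{q}\right)$. Let $g(x)=\frac13x^3+\frac12x^2+\frac16x$, and for positive integers $t,q$ let $\mathcal{M}_m(t,q)$ be the number of $s$-tuples $(n_1,\dots,n_s)$ with $1\le n_i\le t$ satisfying $g(n_1)+\dots+g(n_s)\equiv m\pmod q$. -}

module Defs where

open import Level using (Level)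
open import Algebra.Bundles using (CommutativeRing)
open import Data.Nat using (ℕ; zero; suc; _+_; _*_; _^_; _/_; _%_; _<_; NonZero)
open import Data.Nat.Divisibility using (_∣?_)
open import Data.Nat.Coprimality using (coprime?)
open import Data.Integer as ℤ using (ℤ; +_; -_; _%ℕ_)
open import Data.List using (List; []; _∷_; [_]; map; filter; length; foldr; upTo; concatMap)
open import Data.Vec as Vec using (Vec)
open import Data.Product using (_×_)
open import Data.Sum using (_⊎_)
open import Relation.Nullary using (¬_)
open import Relation.Binary.PropositionalEquality using (_≡_)
import Data.Nat.Properties as ℕP

nonZero6* : ∀ n → .{{NonZero n}} → NonZero (6 * n)
nonZero6* (suc n) = _

range : ℕ → List ℕ
range t = map suc (upTo t)

-- S_n = (2n^3 + 3n^2 + n) / 6   (an exact division: S_n = 1^2 + ... + n^2)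
S : ℕ → ℕ
S n = (2 * n ^ 3 + 3 * n ^ 2 + n) / 6

-- g(x) = x^3/3 + x^2/2 + x/6, evaluated at a positive integer x
-- (its value there is the integer (2x^3 + 3x^2 + x)/6)
g : ℕ → ℕ
g x = (2 * x ^ 3 + 3 * x ^ 2 + x) / 6

tuples : (s t : ℕ) → List (Vec ℕ s)
tuples zero    t = [ Vec.[] ]
tuples (suc s) t = concatMap (λ n → map (n Vec.∷_) (tuples s t)) (range t)

𝓜 : (s m t q : ℕ) → .{{NonZero q}} → ℕ
𝓜 s m t q = length (filter (λ v → Vec.sum (Vec.map g v) % q ℕP.≟ m % q) (tuples s t))

-- Everything living in a commutative ring R (instantiated by ℂ in the paper)
module InRing {c ℓ : Level} (R : CommutativeRing c ℓ) where
  open CommutativeRing R using (Carrier; _≈_; 0#; 1#)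
    renaming (_+_ to _+ᴿ_; _*_ to _*ᴿ_)

  infixr 8 _^ᴿ_
  _^ᴿ_ : Carrier → ℕ → Carrier
  x ^ᴿ zero  = 1#
  x ^ᴿ suc n = x *ᴿ (x ^ᴿ n)

  ofℕ : ℕ → Carrier
  ofℕ zero    = 0#
  ofℕ (suc n) = 1# +ᴿ ofℕ n

  ΣR : List Carrier → Carrier
  ΣR = foldr _+ᴿ_ 0#

  NoZeroDivisors : Set (c Level.⊔ ℓ)
  NoZeroDivisors = ∀ x y → x *ᴿ y ≈ 0# → x ≈ 0# ⊎ y ≈ 0#

  IsPrimitiveRoot : ℕ → Carrier → Set ℓ
  IsPrimitiveRoot q ζ = ζ ^ᴿ q ≈ 1# × (∀ k → 0 < k → k < q → ¬ (ζ ^ᴿ k ≈ 1#))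

  IsNatInverse : ((n : ℕ) → .{{NonZero n}} → Carrier) → Set ℓ
  IsNatInverse inv = ∀ n → .{{_ : NonZero n}} → ofℕ n *ᴿ inv n ≈ 1#

  -- The exponential sums, given ζ = e(1/q) and inverses of positive integers.
  module Sums (q : ℕ) .{{_ : NonZero q}} (ζ : Carrier)
              (inv : (n : ℕ) → .{{NonZero n}} → Carrier) (s m : ℕ) where

    -- e(z/d) for a divisor d of q: with ζ = e(1/q), e(z/d) = ζ^((z mod d)·(q/d))
    e : ℤ → (d : ℕ) → .{{NonZero d}} → Carrier
    e z d = ζ ^ᴿ ((z %ℕ d) * (q / d))

    V₂ : (d : ℕ) → .{{NonZero d}} → ℕ → Carrier
    V₂ d a = ΣR (map (λ n → e (+ (a * S n)) d) (range (6 * d)))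

    V₁ : ℕ → Carrier
    V₁ zero = 0#   -- never used: d ranges over positive divisors
    V₁ d@(suc _) =
      ΣR (map (λ a → ((V₂ d a *ᴿ inv (6 * d)) ^ᴿ s) *ᴿ e (- (+ (a * m))) d)
              (filter (λ a → coprime? a d) (range d)))

    divisorSumV : Carrier
    divisorSumV = ΣR (map V₁ (filter (_∣? q) (range q)))

    -- q^{1-s} 6^{-s} 𝓜_m(6q,q) = q · (6q)^{-s} · 𝓜_m(6q,q)
    rhs : Carrier
    rhs = ofℕ q *ᴿ ((inv (6 * q) {{nonZero6* q}} ^ᴿ s) *ᴿ ofℕ (𝓜 s m (6 * q) q))

-- Put b = a q / d.  The pairs (d, a) with d ∣ q, 1 ≤ a ≤ d and (a, d) = 1 are in bijection with
-- 1 ≤ b ≤ q (d = q / gcd(b, q)), and since S_n mod d has period 6d, the summand of V(d) at a equals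
-- F(b) = (W(b) / 6q)^s e(-bm/q) with W(b) = Σ_{n ≤ 6q} e(b S_n / q).  Expanding W(b)^s as a sum over
-- [1, 6q]^s and summing over b first, orthogonality of the q-th roots of unity (ζ primitive, no zero
-- divisors) leaves q for every tuple with g(n₁) + ⋯ + g(nₛ) ≡ m (mod q) and 0 for all others.
module Submission where

open import Defs
open import Algebra.Bundles using (CommutativeRing)
open import Data.Nat using (ℕ; _≤_; NonZero)
import Data.Nat as ℕ
import Data.Nat.Properties as ℕₚ
open import Data.List using (map)
open import Data.Bool using (if_then_else_)
open import Relation.Nullary using (does)

module Congruences where

  open import Data.Nat
  open import Data.Nat.Properties
  open import Data.Nat.DivMod
  open import Data.Nat.Divisibility
  open import Data.Nat.Tactic.RingSolver
  open import Data.Integer as ℤ using (ℤ; +_; _%ℕ_; _/ℕ_)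
  open import Data.Integer.DivMod using (a≡a%ℕn+[a/ℕn]*n)
  import Data.Integer.Divisibility.Signed as ℤ∣
  import Data.Integer.Tactic.RingSolver as ℤ-Solver
  open import Function using (_⇔_; mk⇔)
  open import Relation.Binary.PropositionalEquality
  open ≡-Reasoning

  Δ : ℕ → ℕ → ℕ
  Δ d n = 6 * (n * n) + 6 * (6 * d + 1) * n + (6 * d + 1) * (12 * d + 1)

  S-shift : ∀ d n → S (6 * d + n) ≡ S n + d * Δ d n
  S-shift d n = begin
    S (6 * d + n)                 ≡⟨ cong (_/ 6) (numerator-shift d n) ⟩
    (6S n + d * Δ d n * 6) / 6    ≡⟨ +-distrib-/-∣ʳ (6S n) (n∣m*n (d * Δ d n)) ⟩
    S n + d * Δ d n * 6 / 6       ≡⟨ cong (λ t → S n + t) (m*n/n≡m (d * Δ d n) 6) ⟩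
    S n + d * Δ d n               ∎
    where
    6S : ℕ → ℕ
    6S x = 2 * x ^ 3 + 3 * x ^ 2 + x
    -- with products instead of _^_, which the solver does not normalise
    numerator-shift : ∀ d n →
      2 * ((6 * d + n) * ((6 * d + n) * ((6 * d + n) * 1))) + 3 * ((6 * d + n) * ((6 * d + n) * 1)) + (6 * d + n)
      ≡ 2 * (n * (n * (n * 1))) + 3 * (n * (n * 1)) + n
        + d * (6 * (n * n) + 6 * (6 * d + 1) * n + (6 * d + 1) * (12 * d + 1)) * 6
    numerator-shift = solve-∀

  ∣[-x]%ℕd+x : ∀ x d .{{_ : NonZero d}} → d ∣ (ℤ.- (+ x)) %ℕ d + x
  ∣[-x]%ℕd+x x d = ℤ∣.∣⇒∣ᵤ (ℤ∣.divides (ℤ.- k) (begin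
    + r ℤ.+ + x                               ≡⟨ move-k (+ r) (+ x) k (+ d) ⟩
    (+ r ℤ.+ k ℤ.* + d) ℤ.+ + x ℤ.- k ℤ.* + d
      ≡⟨ cong (λ t → t ℤ.+ + x ℤ.- k ℤ.* + d) (a≡a%ℕn+[a/ℕn]*n (ℤ.- + x) d) ⟨
    ℤ.- + x ℤ.+ + x ℤ.- k ℤ.* + d             ≡⟨ cancel-x (+ x) k (+ d) ⟩
    ℤ.- k ℤ.* + d                             ∎))
    where
    r = (ℤ.- + x) %ℕ d
    k = (ℤ.- + x) /ℕ d
    move-k : ∀ r x k d → r ℤ.+ x ≡ (r ℤ.+ k ℤ.* d) ℤ.+ x ℤ.- k ℤ.* d
    move-k = ℤ-Solver.solve-∀
    cancel-x : ∀ x k d → ℤ.- x ℤ.+ x ℤ.- k ℤ.* d ≡ ℤ.- k ℤ.* d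
    cancel-x = ℤ-Solver.solve-∀

  ∣+pred*⇔%≡ : ∀ q .{{_ : NonZero q}} t m → q ∣ t + pred q * m ⇔ t % q ≡ m % q
  ∣+pred*⇔%≡ q t m = mk⇔ to from
    where
    to : q ∣ t + pred q * m → t % q ≡ m % q
    to q∣ = begin
      t % q                      ≡⟨ [m+kn]%n≡m%n t m q ⟨
      (t + m * q) % q            ≡⟨ cong (λ n → (t + m * n) % q) (suc-pred q) ⟨
      (t + m * suc (pred q)) % q ≡⟨ cong (_% q) (regroup t m (pred q)) ⟩
      (t + pred q * m + m) % q   ≡⟨ %-remove-+ˡ m q∣ ⟩
      m % q                      ∎
      where
      regroup : ∀ t m p → t + m * suc p ≡ t + p * m + m
      regroup = solve-∀
    from : t % q ≡ m % q → q ∣ t + pred q * m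
    from t≡m = m%n≡0⇒n∣m _ q (begin
      (t + pred q * m) % q                  ≡⟨ %-distribˡ-+ t _ q ⟩
      (t % q + (pred q * m) % q) % q        ≡⟨ cong (λ n → (n + (pred q * m) % q) % q) t≡m ⟩
      (m % q + (pred q * m) % q) % q        ≡⟨ %-distribˡ-+ m _ q ⟨
      (suc (pred q) * m) % q                ≡⟨ cong (λ n → (n * m) % q) (suc-pred q) ⟩
      (q * m) % q                           ≡⟨ n∣m⇒m%n≡0 _ q (m∣m*n m) ⟩
      0                                     ∎)

module GcdFacts where

  open import Data.Nat
  open import Data.Nat.Properties
  open import Data.Nat.GCD using (gcd; gcd[m,n]∣m; gcd[m,n]∣n; gcd[m,n]≢0; c*gcd[m,n]≡gcd[cm,cn])
  open import Data.Nat.Coprimality using (Coprime; coprime⇒gcd≡1; gcd≡1⇒coprime)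
  open import Data.Nat.Divisibility using (_∣_; ∣⇒≤; quotient-∣)
  open import Data.Sum using (inj₂)
  open import Function using (_⇔_; mk⇔)
  open import Relation.Binary.PropositionalEquality
  open ≡-Reasoning

  module _ (d c : ℕ) {q : ℕ} .{{_ : NonZero q}} (d*c≡q : d * c ≡ q) where

    private
      d≢0 : NonZero d
      d≢0 = ≢-nonZero λ d≡0 → ≢-nonZero⁻¹ q (trans (sym d*c≡q) (cong (_* c) d≡0))

    d*gcd[a*c,q]≡q*gcd[a,d] : ∀ a → d * gcd (a * c) q ≡ q * gcd a d
    d*gcd[a*c,q]≡q*gcd[a,d] a = begin
      d * gcd (a * c) q      ≡⟨ cong (λ n → d * gcd (a * c) n) (trans (sym d*c≡q) (*-comm d c)) ⟩
      d * gcd (a * c) (c * d) ≡⟨ cong (λ n → d * gcd n (c * d)) (*-comm a c) ⟩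
      d * gcd (c * a) (c * d) ≡⟨ cong (d *_) (c*gcd[m,n]≡gcd[cm,cn] c a d) ⟨
      d * (c * gcd a d)      ≡⟨ *-assoc d c _ ⟨
      d * c * gcd a d        ≡⟨ cong (_* gcd a d) d*c≡q ⟩
      q * gcd a d            ∎

    coprime⇔d*gcd≡q : ∀ a → Coprime a d ⇔ d * gcd (a * c) q ≡ q
    coprime⇔d*gcd≡q a = mk⇔ to from
      where
      to : Coprime a d → d * gcd (a * c) q ≡ q
      to a⊥d = trans (d*gcd[a*c,q]≡q*gcd[a,d] a) (trans (cong (q *_) (coprime⇒gcd≡1 a⊥d)) (*-identityʳ q))
      from : d * gcd (a * c) q ≡ q → Coprime a d
      from eq = gcd≡1⇒coprime (*-cancelˡ-≡ _ 1 q (trans (sym (d*gcd[a*c,q]≡q*gcd[a,d] a)) (trans eq (sym (*-identityʳ q)))))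

    d*gcd≡q⇒c∣ : ∀ j → d * gcd j q ≡ q → c ∣ j
    d*gcd≡q⇒c∣ j eq = subst (_∣ j) (*-cancelˡ-≡ _ c d {{d≢0}} (trans eq (sym d*c≡q))) (gcd[m,n]∣m j q)

  module _ (q : ℕ) .{{_ : NonZero q}} (j : ℕ) where

    private
      gcd∣q : gcd j q ∣ q
      gcd∣q = gcd[m,n]∣n j q

    cofactor : ℕ
    cofactor = _∣_.quotient gcd∣q

    cofactor*gcd≡q : cofactor * gcd j q ≡ q
    cofactor*gcd≡q = sym (_∣_.equality gcd∣q)

    1≤cofactor : 1 ≤ cofactor
    1≤cofactor = n≢0⇒n>0 λ c≡0 → ≢-nonZero⁻¹ q (trans (sym cofactor*gcd≡q) (cong (_* gcd j q) c≡0))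

    cofactor≤q : cofactor ≤ q
    cofactor≤q = ∣⇒≤ (quotient-∣ gcd∣q)

    *gcd≡q⇒≡cofactor : ∀ d → d * gcd j q ≡ q → d ≡ cofactor
    *gcd≡q⇒≡cofactor d eq = *-cancelʳ-≡ d cofactor (gcd j q) {{gcd≢0}} (trans eq (sym cofactor*gcd≡q))
      where gcd≢0 = ≢-nonZero (gcd[m,n]≢0 j q (inj₂ (≢-nonZero⁻¹ q)))

module FiniteSums {c ℓ} (R : CommutativeRing c ℓ) where

  open import Data.Nat using (zero; suc; z≤n; s≤s; >-nonZero)
  open import Data.Nat.Divisibility using (_∣_; >⇒∤; ∣m+n∣m⇒∣n; ∣-refl)
  open import Function using (_∘′_)
  open import Data.Fin using (toℕ; inject₁; fromℕ)
  open import Data.Fin.Properties using (toℕ<n; toℕ-inject₁; toℕ-fromℕ)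
  open import Data.List using (List; []; _∷_; _++_; map; filter; length; concatMap; applyUpTo; upTo)
  open import Data.List.Properties using (map-∘; map-++; map-cong)
  open import Data.Vec as Vec using (Vec)
  open import Data.Bool using (true; false)
  open import Data.Sum using (inj₁; inj₂)
  open import Relation.Nullary using (Dec; ¬_; contradiction)
  open import Relation.Nullary.Decidable using (dec-true; dec-false)
  open import Relation.Unary using (Pred; Decidable)
  open import Relation.Binary.PropositionalEquality as ≡ using (_≡_; _≢_)

  open CommutativeRing R
  open InRing R using (ΣR; ofℕ; _^ᴿ_; NoZeroDivisors)
  open import Algebra.Properties.Semiring.Sum semiring
  open import Algebra.Properties.Semiring.Exp semiring using (_^_; ^-homo-*)
  open import Algebra.Properties.Monoid.Mult +-monoid using (_×_)
  open import Algebra.Properties.Group +-group using (∙-cancelˡ; x∙y⁻¹≈ε⇒x≈y)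
  open import Algebra.Properties.Ring ring using ([y-z]x≈yx-zx)
  open import Relation.Binary.Reasoning.Setoid setoid

  ^ᴿ≡^ : ∀ x n → x ^ᴿ n ≡ x ^ n
  ^ᴿ≡^ x zero    = ≡.refl
  ^ᴿ≡^ x (suc n) = ≡.cong (x *_) (^ᴿ≡^ x n)

  ofℕ≡×1# : ∀ n → ofℕ n ≡ n × 1#
  ofℕ≡×1# zero    = ≡.refl
  ofℕ≡×1# (suc n) = ≡.cong (1# +_) (ofℕ≡×1# n)

  ∑₁ : ℕ → (ℕ → Carrier) → Carrier
  ∑₁ n f = ∑[ i < n ] f (suc (toℕ i))

  ∑₁-cong : ∀ n {f g : ℕ → Carrier} → (∀ j → f j ≈ g j) → ∑₁ n f ≈ ∑₁ n g
  ∑₁-cong n f≈g = sum-cong-≋ {n} (λ i → f≈g (suc (toℕ i)))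

  ∑₁-vanishing : ∀ n {f : ℕ → Carrier} → (∀ j → 1 ≤ j → j ≤ n → f j ≈ 0#) → ∑₁ n f ≈ 0#
  ∑₁-vanishing n f≈0 = trans (sum-cong-≋ {n} λ i → f≈0 (suc (toℕ i)) (s≤s z≤n) (toℕ<n i)) (sum-replicate-zero n)

  ∑₁-unique : ∀ n (f : ℕ → Carrier) k → 1 ≤ k → k ≤ n →
              (∀ j → 1 ≤ j → j ≤ n → j ≢ k → f j ≈ 0#) → ∑₁ n f ≈ f k
  ∑₁-unique (suc n) f 1 _ _ f≈0 = begin
    f 1 + ∑₁ n (f ∘′ suc)   ≈⟨ +-congˡ (∑₁-vanishing n rest≈0) ⟩
    f 1 + 0#                ≈⟨ +-identityʳ (f 1) ⟩
    f 1                     ∎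
    where
    rest≈0 : ∀ j → 1 ≤ j → j ≤ n → f (suc j) ≈ 0#
    rest≈0 (suc j) _ j≤n = f≈0 (suc (suc j)) (s≤s z≤n) (s≤s j≤n) λ ()
  ∑₁-unique (suc n) f (suc k@(suc _)) _ (s≤s k≤n) f≈0 = begin
    f 1 + ∑₁ n (f ∘′ suc)
      ≈⟨ +-cong (f≈0 1 (s≤s z≤n) (s≤s z≤n) λ ()) (∑₁-unique n (f ∘′ suc) k (s≤s z≤n) k≤n rest≈0) ⟩
    0# + f (suc k)
      ≈⟨ +-identityˡ _ ⟩
    f (suc k)
      ∎
    where
    rest≈0 : ∀ j → 1 ≤ j → j ≤ n → j ≢ k → f (suc j) ≈ 0#
    rest≈0 j _ j≤n j≢k = f≈0 (suc j) (s≤s z≤n) (s≤s j≤n) (j≢k ∘′ ℕₚ.suc-injective)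

  ∑₁-last : ∀ n (f : ℕ → Carrier) → ∑₁ (suc n) f ≈ ∑₁ n f + f (suc n)
  ∑₁-last n f = begin
    ∑₁ (suc n) f
      ≈⟨ sum-init-last (λ i → f (suc (toℕ i))) ⟩
    ∑[ i < n ] f (suc (toℕ (inject₁ i))) + f (suc (toℕ (fromℕ n)))
      ≡⟨ ≡.cong₂ _+_ (sum-cong-≗ {n} λ i → ≡.cong (f ∘′ suc) (toℕ-inject₁ i))
                     (≡.cong (f ∘′ suc) (toℕ-fromℕ n)) ⟩
    ∑₁ n f + f (suc n)
      ∎

  ∑₁-split : ∀ m n (f : ℕ → Carrier) → ∑₁ (m ℕ.+ n) f ≈ ∑₁ m f + ∑₁ n (λ j → f (m ℕ.+ j))
  ∑₁-split zero    n f = sym (+-identityˡ _)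
  ∑₁-split (suc m) n f = trans (+-congˡ (∑₁-split m n (f ∘′ suc))) (sym (+-assoc _ _ _))

  ∑₁-periodic : ∀ P k (f : ℕ → Carrier) → (∀ j → f (P ℕ.+ j) ≈ f j) → ∑₁ (k ℕ.* P) f ≈ k × ∑₁ P f
  ∑₁-periodic P zero    f per = refl
  ∑₁-periodic P (suc k) f per = begin
    ∑₁ (P ℕ.+ k ℕ.* P) f                         ≈⟨ ∑₁-split P (k ℕ.* P) f ⟩
    ∑₁ P f + ∑₁ (k ℕ.* P) (λ j → f (P ℕ.+ j))    ≈⟨ +-congˡ (∑₁-cong (k ℕ.* P) per) ⟩
    ∑₁ P f + ∑₁ (k ℕ.* P) f                      ≈⟨ +-congˡ (∑₁-periodic P k f per) ⟩
    ∑₁ P f + k × ∑₁ P f                          ∎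

  ∑₁-multiples : ∀ d c .{{_ : NonZero c}} (h : ℕ → Carrier) → (∀ j → ¬ c ∣ j → h j ≈ 0#) →
                 ∑₁ (d ℕ.* c) h ≈ ∑₁ d (λ a → h (a ℕ.* c))
  ∑₁-multiples zero    c h h≈0 = refl
  ∑₁-multiples (suc d) c h h≈0 = begin
    ∑₁ (c ℕ.+ d ℕ.* c) h
      ≈⟨ ∑₁-split c (d ℕ.* c) h ⟩
    ∑₁ c h + ∑₁ (d ℕ.* c) (λ j → h (c ℕ.+ j))
      ≈⟨ +-cong first-block (∑₁-multiples d c (λ j → h (c ℕ.+ j)) shifted≈0) ⟩
    h (1 ℕ.* c) + ∑₁ d (λ a → h (c ℕ.+ a ℕ.* c))
      ∎
    where
    first-block : ∑₁ c h ≈ h (1 ℕ.* c)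
    first-block = trans (∑₁-unique c h c (ℕ.>-nonZero⁻¹ c) ℕₚ.≤-refl
                          λ j 1≤j j≤c j≢c → h≈0 j (>⇒∤ {{>-nonZero 1≤j}} (ℕₚ.≤∧≢⇒< j≤c j≢c)))
                        (reflexive (≡.cong h (≡.sym (ℕₚ.*-identityˡ c))))
    shifted≈0 : ∀ j → ¬ c ∣ j → h (c ℕ.+ j) ≈ 0#
    shifted≈0 j c∤j = h≈0 (c ℕ.+ j) (c∤j ∘′ λ c∣c+j → ∣m+n∣m⇒∣n c∣c+j ∣-refl)

  module _ {p} {P : Set p} (P? : Dec P) {x : Carrier} where

    if-true : P → (if does P? then x else 0#) ≈ x
    if-true p = reflexive (≡.cong (λ b → if b then x else 0#) (dec-true P? p))

    if-false : ¬ P → (if does P? then x else 0#) ≈ 0#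
    if-false ¬p = reflexive (≡.cong (λ b → if b then x else 0#) (dec-false P? ¬p))

  ∑₁-comm : ∀ m n (f : ℕ → ℕ → Carrier) →
            ∑₁ m (λ i → ∑₁ n (f i)) ≈ ∑₁ n (λ j → ∑₁ m (λ i → f i j))
  ∑₁-comm m n f = ∑-comm {m} {n} (λ i j → f (suc (toℕ i)) (suc (toℕ j)))

  module _ {a} {A : Set a} where

    ΣR-cong : ∀ (xs : List A) {f g : A → Carrier} → (∀ x → f x ≈ g x) → ΣR (map f xs) ≈ ΣR (map g xs)
    ΣR-cong []       f≈g = refl
    ΣR-cong (x ∷ xs) f≈g = +-cong (f≈g x) (ΣR-cong xs f≈g)

    ΣR-++ : ∀ (xs ys : List Carrier) → ΣR (xs ++ ys) ≈ ΣR xs + ΣR ys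
    ΣR-++ []       ys = sym (+-identityˡ _)
    ΣR-++ (x ∷ xs) ys = trans (+-congˡ (ΣR-++ xs ys)) (sym (+-assoc _ _ _))

    *-distribˡ-ΣR : ∀ x (f : A → Carrier) xs → x * ΣR (map f xs) ≈ ΣR (map (λ y → x * f y) xs)
    *-distribˡ-ΣR x f []       = zeroʳ x
    *-distribˡ-ΣR x f (y ∷ xs) = trans (distribˡ _ _ _) (+-congˡ (*-distribˡ-ΣR x f xs))

    *-distribʳ-ΣR : ∀ x (f : A → Carrier) xs → ΣR (map f xs) * x ≈ ΣR (map (λ y → f y * x) xs)
    *-distribʳ-ΣR x f []       = zeroˡ x
    *-distribʳ-ΣR x f (y ∷ xs) = trans (distribʳ _ _ _) (+-congˡ (*-distribʳ-ΣR x f xs))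

    ΣR-filter : ∀ {p} {P : Pred A p} (P? : Decidable P) (f : A → Carrier) xs →
                ΣR (map f (filter P? xs)) ≈ ΣR (map (λ x → if does (P? x) then f x else 0#) xs)
    ΣR-filter P? f []       = refl
    ΣR-filter P? f (x ∷ xs) with does (P? x)
    ... | true  = +-congˡ (ΣR-filter P? f xs)
    ... | false = trans (ΣR-filter P? f xs) (sym (+-identityˡ _))

    ΣR-count : ∀ {p} {P : Pred A p} (P? : Decidable P) y xs →
               ΣR (map (λ x → if does (P? x) then y else 0#) xs) ≈ length (filter P? xs) × y
    ΣR-count P? y []       = refl
    ΣR-count P? y (x ∷ xs) with does (P? x)
    ... | true  = +-congˡ (ΣR-count P? y xs)
    ... | false = trans (+-identityˡ _) (ΣR-count P? y xs)

    ΣR-concatMap : ∀ {b} {B : Set b} (f : B → Carrier) (h : A → List B) xs →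
                   ΣR (map f (concatMap h xs)) ≈ ΣR (map (λ x → ΣR (map f (h x))) xs)
    ΣR-concatMap f h []       = refl
    ΣR-concatMap f h (x ∷ xs) = begin
      ΣR (map f (h x ++ concatMap h xs))              ≡⟨ ≡.cong ΣR (map-++ f (h x) (concatMap h xs)) ⟩
      ΣR (map f (h x) ++ map f (concatMap h xs))      ≈⟨ ΣR-++ (map f (h x)) _ ⟩
      ΣR (map f (h x)) + ΣR (map f (concatMap h xs))  ≈⟨ +-congˡ (ΣR-concatMap f h xs) ⟩
      ΣR (map f (h x)) + ΣR (map (λ x → ΣR (map f (h x))) xs) ∎

    ∑₁-ΣR-comm : ∀ n (f : ℕ → A → Carrier) xs →
                 ∑₁ n (λ j → ΣR (map (f j) xs)) ≈ ΣR (map (λ x → ∑₁ n (λ j → f j x)) xs)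
    ∑₁-ΣR-comm n f []       = sum-replicate-zero n
    ∑₁-ΣR-comm n f (x ∷ xs) = trans (∑-distrib-+ {n} (λ i → f (suc (toℕ i)) x) _) (+-congˡ (∑₁-ΣR-comm n f xs))

  ΣR-range : ∀ n (f : ℕ → Carrier) → ΣR (map f (range n)) ≡ ∑₁ n f
  ΣR-range n f = ≡.trans (≡.cong ΣR (≡.sym (map-∘ (upTo n)))) (ΣR-applyUpTo n (λ j → j))
    where
    ΣR-applyUpTo : ∀ n (h : ℕ → ℕ) → ΣR (map (f ∘′ suc) (applyUpTo h n)) ≡ ∑[ i < n ] f (suc (h (toℕ i)))
    ΣR-applyUpTo zero    h = ≡.refl
    ΣR-applyUpTo (suc n) h = ≡.cong (f (suc (h 0)) +_) (ΣR-applyUpTo n (h ∘′ suc))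

  ΣR-power : ∀ y (w : ℕ → ℕ) s t →
             ΣR (map (λ n → y ^ w n) (range t)) ^ s ≈ ΣR (map (λ v → y ^ Vec.sum (Vec.map w v)) (tuples s t))
  ΣR-power y w zero    t = sym (+-identityʳ 1#)
  ΣR-power y w (suc s) t = begin
    Y * Y ^ s
      ≈⟨ *-congˡ (ΣR-power y w s t) ⟩
    Y * ΣR (map φ Vs)
      ≈⟨ *-distribʳ-ΣR _ (λ n → y ^ w n) (range t) ⟩
    ΣR (map (λ n → y ^ w n * ΣR (map φ Vs)) (range t))
      ≈⟨ ΣR-cong (range t) (λ n → *-distribˡ-ΣR _ φ Vs) ⟩
    ΣR (map (λ n → ΣR (map (λ v → y ^ w n * φ v) Vs)) (range t))
      ≈⟨ ΣR-cong (range t) (λ n → ΣR-cong Vs (λ v → sym (^-homo-* y (w n) _))) ⟩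
    ΣR (map (λ n → ΣR (map (φ ∘′ (n Vec.∷_)) Vs)) (range t))
      ≡⟨ ≡.cong ΣR (map-cong (λ n → ≡.cong ΣR (map-∘ Vs)) (range t)) ⟩
    ΣR (map (λ n → ΣR (map φ (map (n Vec.∷_) Vs))) (range t))
      ≈⟨ ΣR-concatMap φ (λ n → map (n Vec.∷_) Vs) (range t) ⟨
    ΣR (map φ (tuples (suc s) t))
      ∎
    where
    Y = ΣR (map (λ n → y ^ w n) (range t))
    Vs = tuples s t
    φ : ∀ {k} → Vec ℕ k → Carrier
    φ v = y ^ Vec.sum (Vec.map w v)

  1^≈1 : ∀ n → 1# ^ n ≈ 1#
  1^≈1 zero    = refl
  1^≈1 (suc n) = trans (*-identityˡ _) (1^≈1 n)

  ∑₁-powers-of-root : NoZeroDivisors → ∀ n x → x ^ n ≈ 1# → x ≉ 1# → ∑₁ n (x ^_) ≈ 0#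
  ∑₁-powers-of-root noZeroDivisors n x xⁿ≈1 x≉1 with noZeroDivisors (x - 1#) Σ [x-1]Σ≈0
    where
    Σ = ∑₁ n (x ^_)
    x^1 = x ^ 1
    xΣ≈Σ : x * Σ ≈ Σ
    xΣ≈Σ = ∙-cancelˡ x^1 (x * Σ) Σ (begin
      x^1 + x * Σ          ≈⟨ +-congˡ (*-distribˡ-sum {n} x _) ⟩
      ∑₁ (suc n) (x ^_)    ≈⟨ ∑₁-last n (x ^_) ⟩
      Σ + x * x ^ n        ≈⟨ +-congˡ (*-congˡ xⁿ≈1) ⟩
      Σ + x^1              ≈⟨ +-comm Σ x^1 ⟩
      x^1 + Σ              ∎)
    [x-1]Σ≈0 : (x - 1#) * Σ ≈ 0#
    [x-1]Σ≈0 = begin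
      (x - 1#) * Σ         ≈⟨ [y-z]x≈yx-zx Σ x 1# ⟩
      x * Σ - 1# * Σ       ≈⟨ +-cong xΣ≈Σ (-‿cong (*-identityˡ Σ)) ⟩
      Σ - Σ                ≈⟨ -‿inverseʳ Σ ⟩
      0#                   ∎
  ... | inj₁ x-1≈0 = contradiction (x∙y⁻¹≈ε⇒x≈y x 1# x-1≈0) x≉1
  ... | inj₂ Σ≈0   = Σ≈0

module RootsOfUnity {c ℓ} (R : CommutativeRing c ℓ) (noZeroDivisors : InRing.NoZeroDivisors R)
                    (q : ℕ) .{{_ : NonZero q}} (ζ : CommutativeRing.Carrier R) (ζ-primitive : InRing.IsPrimitiveRoot R q ζ) where

  open import Data.Nat using (suc; pred; _%_)
  open import Data.Nat.DivMod using (m≡m%n+[m/n]*n; m%n<n)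
  open import Data.Nat.Divisibility using (_∣_; _∣?_; divides; m%n≡0⇒n∣m; ∣n⇒∣m*n; ∣m⇒∣m*n; ∣-refl)
  open import Function using (_∘′_)
  open import Data.Product using (proj₁; proj₂)
  open import Relation.Nullary using (yes; no; contradiction)
  import Relation.Binary.PropositionalEquality as ≡

  open CommutativeRing R
  open FiniteSums R
  open import Algebra.Properties.Semiring.Sum semiring using (sum-replicate)
  open import Algebra.Properties.Semiring.Exp semiring using (_^_; ^-homo-*; ^-assocʳ; ^-congˡ)
  open import Algebra.Properties.Monoid.Mult +-monoid using (_×_)
  open import Relation.Binary.Reasoning.Setoid setoid

  E : ℕ → Carrier
  E k = ζ ^ k

  E-homo : ∀ m n → E (m ℕ.+ n) ≈ E m * E n
  E-homo = ^-homo-* ζ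

  E[k*q]≈1 : ∀ k → E (k ℕ.* q) ≈ 1#
  E[k*q]≈1 k = begin
    ζ ^ (k ℕ.* q)   ≡⟨ ≡.cong (ζ ^_) (ℕₚ.*-comm k q) ⟩
    ζ ^ (q ℕ.* k)   ≈⟨ ^-assocʳ ζ q k ⟨
    (ζ ^ q) ^ k     ≈⟨ ^-congˡ k (trans (reflexive (≡.sym (^ᴿ≡^ ζ q))) (proj₁ ζ-primitive)) ⟩
    1# ^ k          ≈⟨ 1^≈1 k ⟩
    1#              ∎

  E-period : ∀ m k → E (m ℕ.+ k ℕ.* q) ≈ E m
  E-period m k = trans (E-homo m (k ℕ.* q)) (trans (*-congˡ (E[k*q]≈1 k)) (*-identityʳ (E m)))

  E-% : ∀ m → E (m % q) ≈ E m
  E-% m = sym (trans (reflexive (≡.cong E (m≡m%n+[m/n]*n m q))) (E-period (m % q) (m ℕ./ q)))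

  E-inverse : ∀ x → E (x ℕ.* pred q) * E x ≈ 1#
  E-inverse x = begin
    E (x ℕ.* pred q) * E x     ≈⟨ E-homo (x ℕ.* pred q) x ⟨
    E (x ℕ.* pred q ℕ.+ x)     ≡⟨ ≡.cong E (≡.trans (ℕₚ.+-comm _ x) (≡.sym (ℕₚ.*-suc x (pred q)))) ⟩
    E (x ℕ.* suc (pred q))     ≡⟨ ≡.cong (λ n → E (x ℕ.* n)) (ℕₚ.suc-pred q) ⟩
    E (x ℕ.* q)                ≈⟨ E[k*q]≈1 x ⟩
    1#                         ∎

  E≈1⇒∣ : ∀ k → E k ≈ 1# → q ∣ k
  E≈1⇒∣ k Eₖ≈1 with k % q ℕₚ.≟ 0
  ... | yes r≡0 = m%n≡0⇒n∣m k q r≡0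
  ... | no  r≢0 = contradiction (trans (reflexive (^ᴿ≡^ ζ (k % q))) (trans (E-% k) Eₖ≈1))
                                (proj₂ ζ-primitive (k % q) (ℕₚ.n≢0⇒n>0 r≢0) (m%n<n k q))

  ∣⇒E≈1 : ∀ k → q ∣ k → E k ≈ 1#
  ∣⇒E≈1 k (divides j ≡.refl) = E[k*q]≈1 j

  ∑₁-E-orthogonal : ∀ k → ∑₁ q (λ b → E (b ℕ.* k)) ≈ (if does (q ∣? k) then q × 1# else 0#)
  ∑₁-E-orthogonal k with q ∣? k
  ... | yes q∣k = trans (∑₁-cong q λ b → ∣⇒E≈1 (b ℕ.* k) (∣n⇒∣m*n b q∣k)) (sum-replicate q {1#})
  ... | no  q∤k = trans (∑₁-cong q λ b → E[b*k]≈Eₖ^b b)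
                        (∑₁-powers-of-root noZeroDivisors q (E k) Eₖ^q≈1 (q∤k ∘′ E≈1⇒∣ k))
    where
    E[b*k]≈Eₖ^b : ∀ b → E (b ℕ.* k) ≈ E k ^ b
    E[b*k]≈Eₖ^b b = trans (reflexive (≡.cong E (ℕₚ.*-comm b k))) (sym (^-assocʳ ζ k b))
    Eₖ^q≈1 : E k ^ q ≈ 1#
    Eₖ^q≈1 = trans (sym (E[b*k]≈Eₖ^b q)) (∣⇒E≈1 (q ℕ.* k) (∣m⇒∣m*n k (∣-refl {q})))

module DivisorSums {c ℓ} (R : CommutativeRing c ℓ) (q : ℕ) .{{_ : NonZero q}}
                   (F : ℕ → CommutativeRing.Carrier R) where

  open import Data.Nat.GCD using (gcd)
  open import Data.Nat.Coprimality using (coprime?)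
  open import Data.Nat.Divisibility using (_∣_; _∣?_; divides)
  open import Data.List using (filter)
  open import Function using (_∘′_)
  open import Relation.Nullary using (¬_; yes; no)
  open import Relation.Nullary.Decidable using (does-⇔)
  open import Relation.Binary.PropositionalEquality as ≡ using (_≡_; _≢_)

  open CommutativeRing R
  open InRing R using (ΣR)
  open FiniteSums R
  open GcdFacts
  open import Relation.Binary.Reasoning.Setoid setoid

  gcd-class : ℕ → ℕ → Carrier
  gcd-class d j = if does (d ℕ.* gcd j q ℕ.≟ q) then F j else 0#

  ∑₁-coprime≈∑₁-gcd-class : ∀ d c → d ℕ.* c ≡ q →
    ΣR (map (λ a → F (a ℕ.* c)) (filter (λ a → coprime? a d) (range d))) ≈ ∑₁ q (gcd-class d)
  ∑₁-coprime≈∑₁-gcd-class d c d*c≡q = begin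
    ΣR (map (λ a → F (a ℕ.* c)) (filter (λ a → coprime? a d) (range d)))
      ≈⟨ ΣR-filter (λ a → coprime? a d) _ (range d) ⟩
    ΣR (map (λ a → if does (coprime? a d) then F (a ℕ.* c) else 0#) (range d))
      ≡⟨ ΣR-range d _ ⟩
    ∑₁ d (λ a → if does (coprime? a d) then F (a ℕ.* c) else 0#)
      ≈⟨ ∑₁-cong d (λ a → reflexive (≡.cong (λ b → if b then F (a ℕ.* c) else 0#)
                                              (does-⇔ (coprime⇔d*gcd≡q d c d*c≡q a) (coprime? a d) (_ ℕ.≟ q)))) ⟩
    ∑₁ d (λ a → gcd-class d (a ℕ.* c))
      ≈⟨ ∑₁-multiples d c {{c≢0}} (gcd-class d) outside-multiples ⟨
    ∑₁ (d ℕ.* c) (gcd-class d)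
      ≡⟨ ≡.cong (λ n → ∑₁ n (gcd-class d)) d*c≡q ⟩
    ∑₁ q (gcd-class d)
      ∎
    where
    c≢0 : ℕ.NonZero c
    c≢0 = ℕ.≢-nonZero λ c≡0 →
      ℕ.≢-nonZero⁻¹ q (≡.trans (≡.sym d*c≡q) (≡.trans (≡.cong (d ℕ.*_) c≡0) (ℕₚ.*-zeroʳ d)))
    outside-multiples : ∀ j → ¬ c ∣ j → gcd-class d j ≈ 0#
    outside-multiples j c∤j = if-false (d ℕ.* gcd j q ℕ.≟ q) (c∤j ∘′ d*gcd≡q⇒c∣ d c d*c≡q j)

  ∑-over-divisors : (Φ : ℕ → Carrier) →
    (∀ d c → d ℕ.* c ≡ q → Φ d ≈ ΣR (map (λ a → F (a ℕ.* c)) (filter (λ a → coprime? a d) (range d)))) →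
    ΣR (map Φ (filter (_∣? q) (range q))) ≈ ∑₁ q F
  ∑-over-divisors Φ Φ≈ = begin
    ΣR (map Φ (filter (_∣? q) (range q)))                          ≈⟨ ΣR-filter (_∣? q) Φ (range q) ⟩
    ΣR (map (λ d → if does (d ∣? q) then Φ d else 0#) (range q))  ≡⟨ ΣR-range q _ ⟩
    ∑₁ q (λ d → if does (d ∣? q) then Φ d else 0#)                ≈⟨ ∑₁-cong q divisor-term ⟩
    ∑₁ q (λ d → ∑₁ q (gcd-class d))                                ≈⟨ ∑₁-comm q q gcd-class ⟩
    ∑₁ q (λ j → ∑₁ q (λ d → gcd-class d j))                        ≈⟨ ∑₁-cong q one-gcd-class ⟩
    ∑₁ q F                                                          ∎
    where
    divisor-term : ∀ d → (if does (d ∣? q) then Φ d else 0#) ≈ ∑₁ q (gcd-class d)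
    divisor-term d with d ∣? q
    ... | yes (divides c q≡c*d) = trans (Φ≈ d c d*c≡q) (∑₁-coprime≈∑₁-gcd-class d c d*c≡q)
      where d*c≡q = ≡.sym (≡.trans q≡c*d (ℕₚ.*-comm c d))
    ... | no  d∤q = sym (∑₁-vanishing q λ j _ _ → if-false (d ℕ.* gcd j q ℕ.≟ q) {F j}
                          λ eq → d∤q (divides (gcd j q) (≡.trans (≡.sym eq) (ℕₚ.*-comm d _))))
    one-gcd-class : ∀ j → ∑₁ q (λ d → gcd-class d j) ≈ F j
    one-gcd-class j = trans (∑₁-unique q (λ d → gcd-class d j) (cofactor q j) (1≤cofactor q j) (cofactor≤q q j) others≈0)
                            (if-true (cofactor q j ℕ.* gcd j q ℕ.≟ q) (cofactor*gcd≡q q j))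
      where
      others≈0 : ∀ d → 1 ℕ.≤ d → d ℕ.≤ q → d ≢ cofactor q j → gcd-class d j ≈ 0#
      others≈0 d _ _ d≢cofactor = if-false (d ℕ.* gcd j q ℕ.≟ q) (d≢cofactor ∘′ *gcd≡q⇒≡cofactor q j d)

module ExponentialSums {c ℓ} (R : CommutativeRing c ℓ) (noZeroDivisors : InRing.NoZeroDivisors R)
  (inv : (n : ℕ) → .{{NonZero n}} → CommutativeRing.Carrier R) (inv-correct : InRing.IsNatInverse R inv)
  (s m q : ℕ) .{{_ : NonZero q}} (ζ : CommutativeRing.Carrier R) (ζ-primitive : InRing.IsPrimitiveRoot R q ζ) where

  open import Data.Nat using (zero; suc; pred; _%_; _/_)
  open import Data.Nat.DivMod using (m*n/n≡m; m%n*o≡m*o%[n*o]; %-congʳ)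
  open import Data.Nat.Divisibility using (_∣?_; divides)
  open import Data.Nat.Coprimality using (coprime?)
  open import Data.Nat.Tactic.RingSolver using (solve-∀)
  open import Data.Integer as ℤ using (+_)
  open import Data.List using (List; filter)
  open import Data.Vec as Vec using (Vec)
  open import Relation.Nullary using (contradiction)
  open import Relation.Nullary.Decidable using (does-⇔)
  open import Relation.Binary.PropositionalEquality as ≡ using (_≡_)

  open CommutativeRing R
  open InRing R
  open Sums q ζ inv s m
  open Congruences using (S-shift; Δ; ∣[-x]%ℕd+x; ∣+pred*⇔%≡)
  open FiniteSums R
  open RootsOfUnity R noZeroDivisors q ζ ζ-primitive
  open import Algebra.Properties.Semiring.Exp semiring using (_^_; ^-congˡ; ^-assocʳ)
  open import Algebra.Properties.CommutativeSemiring.Exp commutativeSemiring using (^-distrib-*)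
  open import Algebra.Properties.Semiring.Mult semiring using (_×_; ×-congʳ; ×-comm-*; ×1-homo-*)
  open import Algebra.Properties.CommutativeSemigroup *-commutativeSemigroup using (x∙yz≈y∙xz; xy∙z≈zx∙y)
  open import Relation.Binary.Reasoning.Setoid setoid

  *-inverse-unique : ∀ {x u v} → u * x ≈ 1# → v * x ≈ 1# → u ≈ v
  *-inverse-unique {x} {u} {v} ux≈1 vx≈1 = begin
    u              ≈⟨ *-identityʳ u ⟨
    u * 1#         ≈⟨ *-congˡ vx≈1 ⟨
    u * (v * x)    ≈⟨ x∙yz≈y∙xz u v x ⟩
    v * (u * x)    ≈⟨ *-congˡ ux≈1 ⟩
    v * 1#         ≈⟨ *-identityʳ v ⟩
    v              ∎

  inv-correct′ : ∀ n .{{_ : NonZero n}} → (n × 1#) * inv n ≈ 1#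
  inv-correct′ n = trans (reflexive (≡.cong (_* inv n) (≡.sym (ofℕ≡×1# n)))) (inv-correct n)

  I : Carrier
  I = inv (6 ℕ.* q) {{nonZero6* q}}

  -- m⁻ ≡ -m (mod q)
  m⁻ : ℕ
  m⁻ = pred q ℕ.* m

  W : ℕ → Carrier
  W b = ΣR (map (λ n → E (b ℕ.* S n)) (range (6 ℕ.* q)))

  F : ℕ → Carrier
  F b = (W b * I) ^ s * E (b ℕ.* m⁻)

  T : Vec ℕ s → ℕ
  T v = Vec.sum (Vec.map g v)

  module Divisor (d c : ℕ) .{{_ : NonZero d}} (d*c≡q : d ℕ.* c ≡ q) where

    instance
      d*c≢0 : NonZero (d ℕ.* c)
      d*c≢0 = ℕ.≢-nonZero λ d*c≡0 → ℕ.≢-nonZero⁻¹ q (≡.trans (≡.sym d*c≡q) d*c≡0)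
      6*d≢0 : NonZero (6 ℕ.* d)
      6*d≢0 = nonZero6* d

    q/d≡c : q / d ≡ c
    q/d≡c = ≡.trans (≡.cong (_/ d) (≡.trans (≡.sym d*c≡q) (ℕₚ.*-comm d c))) (m*n/n≡m c d)

    e≡E[%*c] : ∀ z → e z d ≡ E ((z ℤ.%ℕ d) ℕ.* c)
    e≡E[%*c] z = ≡.trans (^ᴿ≡^ ζ ((z ℤ.%ℕ d) ℕ.* (q / d))) (≡.cong (λ k → E ((z ℤ.%ℕ d) ℕ.* k)) q/d≡c)

    e≈E : ∀ y → e (+ y) d ≈ E (y ℕ.* c)
    e≈E y = begin
      e (+ y) d               ≡⟨ e≡E[%*c] (+ y) ⟩
      E ((y % d) ℕ.* c)       ≡⟨ ≡.cong E (m%n*o≡m*o%[n*o] y d c) ⟩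
      E ((y ℕ.* c) % (d ℕ.* c)) ≡⟨ ≡.cong E (%-congʳ d*c≡q) ⟩
      E ((y ℕ.* c) % q)       ≈⟨ E-% (y ℕ.* c) ⟩
      E (y ℕ.* c)             ∎

    e-neg-inverse : ∀ x → e (ℤ.- + x) d * E (x ℕ.* c) ≈ 1#
    e-neg-inverse x with ∣[-x]%ℕd+x x d
    ... | divides k r+x≡k*d = begin
      e (ℤ.- + x) d * E (x ℕ.* c)   ≡⟨ ≡.cong (_* E (x ℕ.* c)) (e≡E[%*c] (ℤ.- + x)) ⟩
      E (r ℕ.* c) * E (x ℕ.* c)     ≈⟨ E-homo (r ℕ.* c) (x ℕ.* c) ⟨
      E (r ℕ.* c ℕ.+ x ℕ.* c)       ≡⟨ ≡.cong E (≡.sym (ℕₚ.*-distribʳ-+ c r x)) ⟩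
      E ((r ℕ.+ x) ℕ.* c)           ≡⟨ ≡.cong (λ n → E (n ℕ.* c)) r+x≡k*d ⟩
      E (k ℕ.* d ℕ.* c)             ≡⟨ ≡.cong E (≡.trans (ℕₚ.*-assoc k d c) (≡.cong (k ℕ.*_) d*c≡q)) ⟩
      E (k ℕ.* q)                   ≈⟨ E[k*q]≈1 k ⟩
      1#                            ∎
      where r = (ℤ.- + x) ℤ.%ℕ d

    e-neg≈E : ∀ a → e (ℤ.- + (a ℕ.* m)) d ≈ E (a ℕ.* c ℕ.* m⁻)
    e-neg≈E a = *-inverse-unique (e-neg-inverse (a ℕ.* m))
      (trans (reflexive (≡.cong (λ n → E n * E (a ℕ.* m ℕ.* c)) (regroup a c (pred q) m))) (E-inverse (a ℕ.* m ℕ.* c)))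
      where
      regroup : ∀ a c p m → a ℕ.* c ℕ.* (p ℕ.* m) ≡ a ℕ.* m ℕ.* c ℕ.* p
      regroup = solve-∀

    inv≈ : inv (6 ℕ.* d) ≈ (c × 1#) * I
    inv≈ = *-inverse-unique (trans (*-comm _ _) (inv-correct′ (6 ℕ.* d))) (begin
      ((c × 1#) * I) * ((6 ℕ.* d) × 1#)    ≈⟨ xy∙z≈zx∙y _ I _ ⟩
      ((6 ℕ.* d) × 1#) * (c × 1#) * I     ≈⟨ *-congʳ (×1-homo-* (6 ℕ.* d) c) ⟨
      ((6 ℕ.* d ℕ.* c) × 1#) * I
        ≡⟨ ≡.cong (λ n → (n × 1#) * I) (≡.trans (ℕₚ.*-assoc 6 d c) (≡.cong (6 ℕ.*_) d*c≡q)) ⟩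
      ((6 ℕ.* q) × 1#) * I                ≈⟨ inv-correct′ (6 ℕ.* q) {{nonZero6* q}} ⟩
      1#                                  ∎)

    V₂≈ : ∀ a → V₂ d a ≈ ∑₁ (6 ℕ.* d) (λ n → E (a ℕ.* c ℕ.* S n))
    V₂≈ a = trans (reflexive (ΣR-range (6 ℕ.* d) _))
                  (∑₁-cong (6 ℕ.* d) λ n → trans (e≈E (a ℕ.* S n)) (reflexive (≡.cong E (regroup a (S n) c))))
      where
      regroup : ∀ a x c → a ℕ.* x ℕ.* c ≡ a ℕ.* c ℕ.* x
      regroup = solve-∀

    -- S is periodic modulo d with period 6d, so W (a c) runs c times over one period
    W≈ : ∀ a → W (a ℕ.* c) ≈ c × ∑₁ (6 ℕ.* d) (λ n → E (a ℕ.* c ℕ.* S n))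
    W≈ a = begin
      W (a ℕ.* c)                  ≡⟨ ΣR-range (6 ℕ.* q) f ⟩
      ∑₁ (6 ℕ.* q) f               ≡⟨ ≡.cong (λ n → ∑₁ n f) 6q≡c*6d ⟩
      ∑₁ (c ℕ.* (6 ℕ.* d)) f       ≈⟨ ∑₁-periodic (6 ℕ.* d) c f period ⟩
      c × ∑₁ (6 ℕ.* d) f           ∎
      where
      f : ℕ → Carrier
      f n = E (a ℕ.* c ℕ.* S n)
      6q≡c*6d : 6 ℕ.* q ≡ c ℕ.* (6 ℕ.* d)
      6q≡c*6d = ≡.trans (≡.cong (6 ℕ.*_) (≡.sym d*c≡q)) (regroup d c)
        where regroup : ∀ d c → 6 ℕ.* (d ℕ.* c) ≡ c ℕ.* (6 ℕ.* d)
              regroup = solve-∀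
      period : ∀ n → f (6 ℕ.* d ℕ.+ n) ≈ f n
      period n = begin
        E (a ℕ.* c ℕ.* S (6 ℕ.* d ℕ.+ n))
          ≡⟨ ≡.cong (λ x → E (a ℕ.* c ℕ.* x)) (S-shift d n) ⟩
        E (a ℕ.* c ℕ.* (S n ℕ.+ d ℕ.* Δ d n))
          ≡⟨ ≡.cong E (regroup a c d (S n) (Δ d n)) ⟩
        E (a ℕ.* c ℕ.* S n ℕ.+ a ℕ.* Δ d n ℕ.* (d ℕ.* c))
          ≡⟨ ≡.cong (λ k → E (a ℕ.* c ℕ.* S n ℕ.+ a ℕ.* Δ d n ℕ.* k)) d*c≡q ⟩
        E (a ℕ.* c ℕ.* S n ℕ.+ a ℕ.* Δ d n ℕ.* q)
          ≈⟨ E-period (a ℕ.* c ℕ.* S n) (a ℕ.* Δ d n) ⟩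
        E (a ℕ.* c ℕ.* S n)
          ∎
        where regroup : ∀ a c d x y → a ℕ.* c ℕ.* (x ℕ.+ d ℕ.* y) ≡ a ℕ.* c ℕ.* x ℕ.+ a ℕ.* y ℕ.* (d ℕ.* c)
              regroup = solve-∀

    V₂/6d≈W/6q : ∀ a → V₂ d a * inv (6 ℕ.* d) ≈ W (a ℕ.* c) * I
    V₂/6d≈W/6q a = begin
      V₂ d a * inv (6 ℕ.* d)   ≈⟨ *-cong (V₂≈ a) inv≈ ⟩
      Σ * ((c × 1#) * I)        ≈⟨ *-assoc Σ _ I ⟨
      Σ * (c × 1#) * I          ≈⟨ *-congʳ (trans (×-comm-* c Σ 1#) (×-congʳ c (*-identityʳ Σ))) ⟩
      c × Σ * I                 ≈⟨ *-congʳ (W≈ a) ⟨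
      W (a ℕ.* c) * I           ∎
      where Σ = ∑₁ (6 ℕ.* d) (λ n → E (a ℕ.* c ℕ.* S n))

    V-summand≈F : ∀ a → (V₂ d a * inv (6 ℕ.* d)) ^ᴿ s * e (ℤ.- + (a ℕ.* m)) d ≈ F (a ℕ.* c)
    V-summand≈F a = trans (reflexive (≡.cong (_* e (ℤ.- + (a ℕ.* m)) d) (^ᴿ≡^ _ s)))
                          (*-cong (^-congˡ s (V₂/6d≈W/6q a)) (e-neg≈E a))

  V₁≈ : ∀ d c → d ℕ.* c ≡ q → V₁ d ≈ ΣR (map (λ a → F (a ℕ.* c)) (filter (λ a → coprime? a d) (range d)))
  V₁≈ zero        c 0≡q = contradiction (≡.sym 0≡q) (ℕ.≢-nonZero⁻¹ q)
  V₁≈ d@(suc _)   c d*c≡q = ΣR-cong (filter (λ a → coprime? a d) (range d)) (Divisor.V-summand≈F d c d*c≡q)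

  Tuples : List (Vec ℕ s)
  Tuples = tuples s (6 ℕ.* q)

  W^s≈ : ∀ b → W b ^ s ≈ ΣR (map (λ v → E (b ℕ.* T v)) Tuples)
  W^s≈ b = begin
    W b ^ s                                            ≈⟨ ^-congˡ s (ΣR-cong (range (6 ℕ.* q)) (λ n → E[b*n]≈E[b]^n (S n))) ⟩
    ΣR (map (λ n → E b ^ S n) (range (6 ℕ.* q))) ^ s    ≈⟨ ΣR-power (E b) S s (6 ℕ.* q) ⟩
    ΣR (map (λ v → E b ^ T v) Tuples)                   ≈⟨ ΣR-cong Tuples (λ v → E[b*n]≈E[b]^n (T v)) ⟨
    ΣR (map (λ v → E (b ℕ.* T v)) Tuples)               ∎
    where
    E[b*n]≈E[b]^n : ∀ n → E (b ℕ.* n) ≈ E b ^ n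
    E[b*n]≈E[b]^n n = sym (^-assocʳ ζ b n)

  χ : ℕ → Vec ℕ s → Carrier
  χ b v = E (b ℕ.* (T v ℕ.+ m⁻))

  F≈ : ∀ b → F b ≈ I ^ s * ΣR (map (χ b) Tuples)
  F≈ b = begin
    (W b * I) ^ s * E (b ℕ.* m⁻)                               ≈⟨ *-congʳ (trans (^-distrib-* (W b) I s) (*-comm _ _)) ⟩
    I ^ s * W b ^ s * E (b ℕ.* m⁻)                             ≈⟨ *-assoc (I ^ s) _ _ ⟩
    I ^ s * (W b ^ s * E (b ℕ.* m⁻))                           ≈⟨ *-congˡ (*-congʳ (W^s≈ b)) ⟩
    I ^ s * (ΣR (map (λ v → E (b ℕ.* T v)) Tuples) * E (b ℕ.* m⁻))
      ≈⟨ *-congˡ (*-distribʳ-ΣR _ _ Tuples) ⟩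
    I ^ s * ΣR (map (λ v → E (b ℕ.* T v) * E (b ℕ.* m⁻)) Tuples)
      ≈⟨ *-congˡ (ΣR-cong Tuples λ v → trans (sym (E-homo (b ℕ.* T v) (b ℕ.* m⁻)))
                                            (reflexive (≡.cong E (≡.sym (ℕₚ.*-distribˡ-+ b (T v) m⁻))))) ⟩
    I ^ s * ΣR (map (χ b) Tuples)                               ∎

  ∑₁-E≈indicator : ∀ t →
    ∑₁ q (λ b → E (b ℕ.* (t ℕ.+ m⁻))) ≈ (if does (t % q ℕₚ.≟ m % q) then q × 1# else 0#)
  ∑₁-E≈indicator t = trans (∑₁-E-orthogonal (t ℕ.+ m⁻))
    (reflexive (≡.cong (λ b → if b then q × 1# else 0#) (does-⇔ (∣+pred*⇔%≡ q t m) (q ∣? _) (_ ℕₚ.≟ _))))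

  I^s*count≈rhs : I ^ s * (𝓜 s m (6 ℕ.* q) q × (q × 1#)) ≈ rhs
  I^s*count≈rhs = begin
    I ^ s * (M × (q × 1#))               ≈⟨ *-congˡ (trans (×-comm-* M (q × 1#) 1#) (×-congʳ M (*-identityʳ (q × 1#)))) ⟨
    I ^ s * ((q × 1#) * (M × 1#))        ≈⟨ x∙yz≈y∙xz (I ^ s) (q × 1#) (M × 1#) ⟩
    (q × 1#) * (I ^ s * (M × 1#))        ≡⟨ ≡.cong₂ (λ x y → x * (y * (M × 1#))) (ofℕ≡×1# q) (^ᴿ≡^ I s) ⟨
    ofℕ q * (I ^ᴿ s * (M × 1#))          ≡⟨ ≡.cong (λ x → ofℕ q * (I ^ᴿ s * x)) (ofℕ≡×1# M) ⟨
    rhs                                  ∎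
    where M = 𝓜 s m (6 ℕ.* q) q

lemma8p4 : ∀ {c ℓ} (R : CommutativeRing c ℓ) →
    let open CommutativeRing R in
    let open InRing R in
    NoZeroDivisors →
    (inv : (n : ℕ) → .{{NonZero n}} → Carrier) → IsNatInverse inv →
    (s m : ℕ) → 1 ≤ s → 1 ≤ m →
    (q : ℕ) → .{{_ : NonZero q}} →
    (ζ : Carrier) → IsPrimitiveRoot q ζ →
    Sums.divisorSumV q ζ inv s m ≈ Sums.rhs q ζ inv s m
-- The identity holds for all s and m.
lemma8p4 R noZeroDivisors inv inv-correct s m _ _ q ζ ζ-primitive = begin
  divisorSumV
    ≈⟨ ∑-over-divisors V₁ V₁≈ ⟩
  ∑₁ q F
    ≈⟨ ∑₁-cong q F≈ ⟩
  ∑₁ q (λ b → I ^ s * ΣR (map (χ b) Tuples))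
    ≈⟨ *-distribˡ-sum {q} (I ^ s) _ ⟨
  I ^ s * ∑₁ q (λ b → ΣR (map (χ b) Tuples))
    ≈⟨ *-congˡ (∑₁-ΣR-comm q χ Tuples) ⟩
  I ^ s * ΣR (map (λ v → ∑₁ q (λ b → χ b v)) Tuples)
    ≈⟨ *-congˡ (ΣR-cong Tuples λ v → ∑₁-E≈indicator (T v)) ⟩
  I ^ s * ΣR (map (λ v → if does (T v ℕ.% q ℕₚ.≟ m ℕ.% q) then q × 1# else 0#) Tuples)
    ≈⟨ *-congˡ (ΣR-count (λ v → T v ℕ.% q ℕₚ.≟ m ℕ.% q) (q × 1#) Tuples) ⟩
  I ^ s * (𝓜 s m (6 ℕ.* q) q × (q × 1#))
    ≈⟨ I^s*count≈rhs ⟩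
  rhs
    ∎
  where
  open CommutativeRing R
  open InRing R
  open ExponentialSums R noZeroDivisors inv inv-correct s m q ζ ζ-primitive
  open Sums q ζ inv s m
  open FiniteSums R
  open DivisorSums R q F using (∑-over-divisors)
  open import Algebra.Properties.Semiring.Sum semiring using (*-distribˡ-sum)
  open import Algebra.Properties.Semiring.Exp semiring using (_^_)
  open import Algebra.Properties.Monoid.Mult +-monoid using (_×_)
  open import Relation.Binary.Reasoning.Setoid setoid
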